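{- If $n$ is a positive integer divisible by $4$, then $\mathrm{ex}^*(n, C_3, P_3) = n$.
   Context: An edge-coloring is proper if any two edges sharing a vertex receive different colors. An edge-colored subgraph is rainbow if no two of its edges have the same color. $P_3$ denotes the path with $3$ edges and $C_3$ the triangle. $\mathrm{ex}^*(n,H,F)$ is the maximum number of rainbow copies of $H$ (as subgraphs) in an $n$-vertex simple graph with a proper edge-coloring containing no rainbow copy of $F$. -}

module Defs where

open import Data.Nat using (ℕ; _<ᵇ_; _≡ᵇ_)
open import Data.Bool using (Bool; true; false; _∧_; not; if_then_else_)
open import Data.Fin using (Fin; toℕ)
open import Data.List using (List; map; allFin)
open import Data.Nat.ListAction using (sum)
open import Data.Product using (∃-syntax; _×_)
open import Relation.Binary.PropositionalEquality using (_≡_; _≢_)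
open import Relation.Nullary using (¬_)

record Graph (n : ℕ) : Set where
  field
    adj    : Fin n → Fin n → Bool
    sym    : ∀ u v → adj u v ≡ adj v u
    irrefl : ∀ v → adj v v ≡ false
open Graph public

record EdgeColouring {n : ℕ} (G : Graph n) : Set where
  field
    col    : Fin n → Fin n → ℕ
    colSym : ∀ u v → adj G u v ≡ true → col u v ≡ col v u
open EdgeColouring public

Proper : ∀ {n} (G : Graph n) → EdgeColouring G → Set
Proper {n} G c = ∀ (u v w : Fin n) → adj G u v ≡ true → adj G u w ≡ true →
                 v ≢ w → col c u v ≢ col c u w

RainbowP3 : ∀ {n} (G : Graph n) → EdgeColouring G → Set
RainbowP3 {n} G c =
  ∃[ a ] ∃[ b ] ∃[ x ] ∃[ d ]
    (a ≢ b × a ≢ x × a ≢ d × b ≢ x × b ≢ d × x ≢ d) ×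
    (adj G a b ≡ true × adj G b x ≡ true × adj G x d ≡ true) ×
    (col c a b ≢ col c b x × col c a b ≢ col c x d × col c b x ≢ col c x d)

rainbowTri? : ∀ {n} (G : Graph n) → EdgeColouring G → Fin n → Fin n → Fin n → Bool
rainbowTri? G c a b x =
  (toℕ a <ᵇ toℕ b) ∧ (toℕ b <ᵇ toℕ x) ∧
  adj G a b ∧ adj G b x ∧ adj G a x ∧
  not (col c a b ≡ᵇ col c b x) ∧ not (col c a b ≡ᵇ col c a x) ∧
  not (col c b x ≡ᵇ col c a x)

#rainbowC3 : ∀ {n} (G : Graph n) → EdgeColouring G → ℕ
#rainbowC3 {n} G c =
  sum (map (λ a → sum (map (λ b → sum (map (λ x →
    if rainbowTri? G c a b x then 1 else 0) (allFin n))) (allFin n))) (allFin n))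

-- A vertex v of a rainbow triangle vpq sees only the three colours of that triangle: an edge vd of
-- any other colour would make d–v–p–q a rainbow P₃. By properness v then has at most three
-- neighbours, so it lies in at most C(3,2) = 3 rainbow triangles; summing over the vertices counts
-- every rainbow triangle three times, hence there are at most n of them. Equality holds for n/4
-- disjoint copies of K₄, each coloured by its three perfect matchings: every triangle is rainbow,
-- and a path with three edges covers all four vertices of its K₄, so its first and last edges
-- form a perfect matching and get the same colour.
module Submission where

open import Defs
open import Data.Bool using (Bool; true; false; _∧_; if_then_else_)
open import Data.Bool.Properties using (T-≡)
open import Data.Empty using (⊥-elim)
open import Data.Fin using (Fin; zero; suc; toℕ; _↑ˡ_; _↑ʳ_; combine; quotient; remainder; punchIn)
open import Data.Fin.Patterns using (0F; 1F; 2F; 3F)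
open import Data.Fin.Properties
  using (any?; all?; punchInᵢ≢i; toℕ-injective; remQuot-combine; combine-remQuot)
  renaming (_≟_ to _≟ᶠ_)
open import Data.List using (map; allFin; tabulate)
open import Data.List.Properties using (map-tabulate)
import Data.Nat.ListAction as List
open import Data.Nat using (ℕ; zero; suc; _+_; _*_; _≤_; _<_; z≤n; s≤s; _<ᵇ_)
open import Data.Nat.Combinatorics using (_C_; nC1≡n; nCk+nC[k+1]≡[n+1]C[k+1])
open import Data.Nat.Divisibility using (_∣_; divides)
open import Data.Nat.Properties
  using ( +-0-commutativeMonoid; _≟_; _<?_; +-assoc; +-identityʳ; +-mono-≤; m≤m+n; m≤n+m
        ; ≤-refl; ≤-reflexive; ≤-trans; <-trans; <-asym; <-cmp; <-irrefl; *-cancelʳ-≤; *-cancelʳ-≡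
        ; module ≤-Reasoning)
open import Data.Nat.Tactic.RingSolver using (solve-∀)
open import Data.Product using (Σ; ∃-syntax; _×_; _,_; proj₁; proj₂)
open import Data.Sum using (_⊎_; inj₁; inj₂)
import Data.Sum as Sum
open import Data.Vec using (Vec; []; _∷_; lookup)
open import Function.Bundles using (mk⇔)
open import Relation.Binary.Definitions using (tri<; tri≈; tri>)
open import Relation.Binary.PropositionalEquality
  using (_≡_; _≢_; refl; cong; cong₂; trans; module ≡-Reasoning)
import Relation.Binary.PropositionalEquality as ≡
open import Relation.Nullary using (Dec; yes; no; does; ¬_; ¬?; _×-dec_; _→-dec_)
import Relation.Nullary.Decidable as Dec
open import Relation.Nullary.Decidable
  using (T?; toWitness; dec-true; dec-false; does-⇔; decidable-stable)
open import Relation.Unary using (Pred; Decidable)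

open import Algebra.Properties.CommutativeMonoid.Sum +-0-commutativeMonoid
  using (sum-syntax; ∑-distrib-+; ∑-comm; sum-cong-≗; sum-remove; sum-replicate-zero)

𝟙 : Bool → ℕ
𝟙 b = if b then 1 else 0

𝟙-true : ∀ {a} {A : Set a} (A? : Dec A) → A → 𝟙 (does A?) ≡ 1
𝟙-true A? a = cong 𝟙 (dec-true A? a)

𝟙-false : ∀ {a} {A : Set a} (A? : Dec A) → ¬ A → 𝟙 (does A?) ≡ 0
𝟙-false A? ¬a = cong 𝟙 (dec-false A? ¬a)

does≡true⇒ : ∀ {a} {A : Set a} (A? : Dec A) → does A? ≡ true → A
does≡true⇒ (yes a) _ = a

𝟙≢0⇒ : ∀ {a} {A : Set a} (A? : Dec A) → 𝟙 (does A?) ≢ 0 → A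
𝟙≢0⇒ (yes a) _  = a
𝟙≢0⇒ (no _)  ≢0 = ⊥-elim (≢0 refl)

𝟙-mono : ∀ {p q} {P : Set p} {Q : Set q} → (P → Q) → (P? : Dec P) (Q? : Dec Q) →
         𝟙 (does P?) ≤ 𝟙 (does Q?)
𝟙-mono P⇒Q (no _)  Q? = z≤n
𝟙-mono P⇒Q (yes p) Q? rewrite dec-true Q? (P⇒Q p) = ≤-refl

𝟙-cover₃ : ∀ {p q r s} {P : Set p} {Q : Set q} {R : Set r} {S : Set s} → (P → Q ⊎ R ⊎ S) →
           (P? : Dec P) (Q? : Dec Q) (R? : Dec R) (S? : Dec S) →
           𝟙 (does P?) ≤ 𝟙 (does Q?) + 𝟙 (does R?) + 𝟙 (does S?)
𝟙-cover₃ cover (no _)  Q? R? S? = z≤n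
𝟙-cover₃ cover (yes p) Q? R? S? with cover p
... | inj₁ q        rewrite dec-true Q? q = s≤s z≤n
... | inj₂ (inj₁ r) rewrite dec-true R? r = ≤-trans (m≤n+m 1 (𝟙 (does Q?))) (m≤m+n _ (𝟙 (does S?)))
... | inj₂ (inj₂ s) rewrite dec-true S? s = m≤n+m 1 (𝟙 (does Q?) + 𝟙 (does R?))

sum-map-allFin : ∀ n (f : Fin n → ℕ) → List.sum (map f (allFin n)) ≡ ∑[ i < n ] f i
sum-map-allFin n f = trans (cong List.sum (map-tabulate (λ i → i) f)) (sum-tabulate n f)
  where
  sum-tabulate : ∀ n (f : Fin n → ℕ) → List.sum (tabulate f) ≡ ∑[ i < n ] f i
  sum-tabulate zero    f = refl
  sum-tabulate (suc n) f = cong (f zero +_) (sum-tabulate n (λ i → f (suc i)))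

∑-mono-≤ : ∀ {n} {f g : Fin n → ℕ} → (∀ i → f i ≤ g i) → ∑[ i < n ] f i ≤ ∑[ i < n ] g i
∑-mono-≤ {zero}  f≤g = z≤n
∑-mono-≤ {suc n} f≤g = +-mono-≤ (f≤g zero) (∑-mono-≤ (λ i → f≤g (suc i)))

∑-const : ∀ n k → ∑[ i < n ] k ≡ n * k
∑-const zero    k = refl
∑-const (suc n) k = cong (k +_) (∑-const n k)

∑-distrib₃ : ∀ {n} (f g h : Fin n → ℕ) →
             ∑[ i < n ] (f i + g i + h i) ≡ ∑[ i < n ] f i + ∑[ i < n ] g i + ∑[ i < n ] h i
∑-distrib₃ f g h = trans (∑-distrib-+ (λ i → f i + g i) h) (cong (_+ _) (∑-distrib-+ f g))

∑≢0⇒∃≢0 : ∀ {n} (f : Fin n → ℕ) → ∑[ i < n ] f i ≢ 0 → ∃[ i ] f i ≢ 0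
∑≢0⇒∃≢0 {zero}  f ∑≢0 = ⊥-elim (∑≢0 refl)
∑≢0⇒∃≢0 {suc n} f ∑≢0 with f zero ≟ 0
... | no  f₀≢0 = zero , f₀≢0
... | yes f₀≡0 with ∑≢0⇒∃≢0 (λ i → f (suc i)) (λ ∑≡0 → ∑≢0 (cong₂ _+_ f₀≡0 ∑≡0))
...   | i , fᵢ≢0 = suc i , fᵢ≢0

∑-split : ∀ m {n} (f : Fin (m + n) → ℕ) →
          ∑[ i < m + n ] f i ≡ ∑[ i < m ] f (i ↑ˡ n) + ∑[ j < n ] f (m ↑ʳ j)
∑-split zero    f = refl
∑-split (suc m) f =
  trans (cong (f zero +_) (∑-split m (λ i → f (suc i)))) (≡.sym (+-assoc (f zero) _ _))

∑-combine : ∀ m {n} (f : Fin (m * n) → ℕ) →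
            ∑[ u < m * n ] f u ≡ ∑[ i < m ] ∑[ j < n ] f (combine i j)
∑-combine zero    f = refl
∑-combine (suc m) {n} f =
  trans (∑-split n f) (cong (∑[ j < n ] f (j ↑ˡ m * n) +_) (∑-combine m (λ u → f (n ↑ʳ u))))

∑-single : ∀ {n} {f : Fin n → ℕ} i → (∀ j → j ≢ i → f j ≡ 0) → ∑[ j < n ] f j ≡ f i
∑-single {suc n} {f} i f≡0 = begin
  ∑[ j < suc n ] f j                ≡⟨ sum-remove f ⟩
  f i + ∑[ j < n ] f (punchIn i j)  ≡⟨ cong (f i +_) (sum-cong-≗ (λ j → f≡0 _ (punchInᵢ≢i i j))) ⟩
  f i + ∑[ j < n ] 0                ≡⟨ cong (f i +_) (sum-replicate-zero n) ⟩
  f i + 0                           ≡⟨ +-identityʳ (f i) ⟩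
  f i                               ∎
  where open ≡-Reasoning

∑-atMostOne : ∀ {n p} {P : Pred (Fin n) p} (P? : Decidable P) → (∀ i j → P i → P j → i ≡ j) →
              ∑[ i < n ] 𝟙 (does (P? i)) ≤ 1
∑-atMostOne {n} P? unique with any? P?
... | yes (i , pᵢ) = ≤-reflexive (trans
      (∑-single i λ j j≢i → 𝟙-false (P? j) λ pⱼ → j≢i (unique j i pⱼ pᵢ))
      (𝟙-true (P? i) pᵢ))
... | no ¬∃ = ≤-trans (≤-reflexive (trans
      (sum-cong-≗ λ j → 𝟙-false (P? j) λ pⱼ → ¬∃ (j , pⱼ))
      (sum-replicate-zero n))) z≤n

∑-pairs : ∀ n (A : Fin n → Bool) →
          ∑[ b < n ] ∑[ x < n ] 𝟙 ((toℕ b <ᵇ toℕ x) ∧ A b ∧ A x) ≡ (∑[ i < n ] 𝟙 (A i)) C 2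
∑-pairs zero    A = refl
∑-pairs (suc n) A =
  trans (cong (∑[ x < n ] 𝟙 (A zero ∧ A (suc x)) +_) (∑-pairs n (λ i → A (suc i))))
        (pairs-with (A zero))
  where
  d = ∑[ i < n ] 𝟙 (A (suc i))
  pairs-with : ∀ a → ∑[ x < n ] 𝟙 (a ∧ A (suc x)) + d C 2 ≡ (𝟙 a + d) C 2
  pairs-with true  = trans (cong (_+ d C 2) (≡.sym (nC1≡n d))) (nCk+nC[k+1]≡[n+1]C[k+1] d 1)
  pairs-with false = cong (_+ d C 2) (sum-replicate-zero n)

m+m+m≡m*3 : ∀ m → m + m + m ≡ m * 3
m+m+m≡m*3 = solve-∀

n≤3⇒nC2≤3 : ∀ {n} → n ≤ 3 → n C 2 ≤ 3
n≤3⇒nC2≤3 {0} _ = z≤n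
n≤3⇒nC2≤3 {1} _ = z≤n
n≤3⇒nC2≤3 {2} _ = s≤s z≤n
n≤3⇒nC2≤3 {3} _ = ≤-refl
n≤3⇒nC2≤3 {suc (suc (suc (suc _)))} (s≤s (s≤s (s≤s ())))

module _ {n ℓ} {R : Fin n → Fin n → Set ℓ} (R? : ∀ u v → Dec (R u v))
         (R-sym : ∀ {u v} → R u v → R v u) (R-irrefl : ∀ {v} → ¬ R v v) where

  relationGraph : Graph n
  relationGraph = record
    { adj    = λ u v → does (R? u v)
    ; sym    = λ u v → does-⇔ (mk⇔ R-sym R-sym) (R? u v) (R? v u)
    ; irrefl = λ v → dec-false (R? v v) R-irrefl
    }

  relationGraph-adj⇒ : ∀ {u v} → adj relationGraph u v ≡ true → R u v
  relationGraph-adj⇒ {u} {v} = does≡true⇒ (R? u v)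

module _ {n} (G : Graph n) where

  adj? : ∀ u v → Dec (adj G u v ≡ true)
  adj? u v = Dec.map T-≡ (T? (adj G u v))

  adj-sym : ∀ {u v} → adj G u v ≡ true → adj G v u ≡ true
  adj-sym {u} {v} uv = trans (sym G v u) uv

  adj⇒≢ : ∀ {u v} → adj G u v ≡ true → u ≢ v
  adj⇒≢ {u} uu refl with () ← trans (≡.sym uu) (irrefl G u)

  degree : Fin n → ℕ
  degree v = ∑[ d < n ] 𝟙 (adj G v d)

module _ {n} (G : Graph n) (c : EdgeColouring G) where

  RainbowTriangle : Fin n → Fin n → Fin n → Set
  RainbowTriangle a b x = adj G a b ≡ true × adj G b x ≡ true × adj G a x ≡ true ×
                          col c a b ≢ col c b x × col c a b ≢ col c a x × col c b x ≢ col c a x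

  rainbowTriangle? : ∀ a b x → Dec (RainbowTriangle a b x)
  rainbowTriangle? a b x = adj? G a b ×-dec adj? G b x ×-dec adj? G a x ×-dec
    ¬? (col c a b ≟ col c b x) ×-dec ¬? (col c a b ≟ col c a x) ×-dec ¬? (col c b x ≟ col c a x)

  rainbowTriangle-swap₁₂ : ∀ {a b x} → RainbowTriangle a b x → RainbowTriangle b a x
  rainbowTriangle-swap₁₂ {a} {b} {x} (ab , bx , ax , ab≢bx , ab≢ax , bx≢ax) =
    adj-sym G ab , ax , bx ,
    (λ e → ab≢ax (trans ab≡ba e)) , (λ e → ab≢bx (trans ab≡ba e)) , (λ e → bx≢ax (≡.sym e))
    where ab≡ba = colSym c a b ab

  rainbowTriangle-swap₂₃ : ∀ {a b x} → RainbowTriangle a b x → RainbowTriangle a x b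
  rainbowTriangle-swap₂₃ {a} {b} {x} (ab , bx , ax , ab≢bx , ab≢ax , bx≢ax) =
    ax , adj-sym G bx , ab ,
    (λ e → bx≢ax (trans bx≡xb (≡.sym e))) , (λ e → ab≢ax (≡.sym e)) ,
    (λ e → ab≢bx (≡.sym (trans bx≡xb e)))
    where bx≡xb = colSym c b x bx

  SortedRainbowTriangle : Fin n → Fin n → Fin n → Set
  SortedRainbowTriangle a b x = toℕ a < toℕ b × toℕ b < toℕ x × RainbowTriangle a b x

  -- Its `does` is definitionally rainbowTri? G c a b x.
  sortedRainbowTriangle? : ∀ a b x → Dec (SortedRainbowTriangle a b x)
  sortedRainbowTriangle? a b x = toℕ a <? toℕ b ×-dec toℕ b <? toℕ x ×-dec rainbowTriangle? a b x

  #rainbowC3≡∑ : #rainbowC3 G c ≡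
                 ∑[ a < n ] ∑[ b < n ] ∑[ x < n ] 𝟙 (does (sortedRainbowTriangle? a b x))
  #rainbowC3≡∑ = trans (sum-map-allFin n row) (sum-cong-≗ λ a →
                 trans (sum-map-allFin n (entry a)) (sum-cong-≗ λ b →
                 sum-map-allFin n λ x → 𝟙 (rainbowTri? G c a b x)))
    where
    entry : Fin n → Fin n → ℕ
    entry a b = List.sum (map (λ x → 𝟙 (rainbowTri? G c a b x)) (allFin n))
    row : Fin n → ℕ
    row a = List.sum (map (entry a) (allFin n))

  TriangleAt : Fin n → Fin n → Fin n → Set
  TriangleAt v b x = toℕ b < toℕ x × RainbowTriangle v b x

  triangleAt? : ∀ v b x → Dec (TriangleAt v b x)
  triangleAt? v b x = toℕ b <? toℕ x ×-dec rainbowTriangle? v b x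

  trianglesAt : Fin n → ℕ
  trianglesAt v = ∑[ b < n ] ∑[ x < n ] 𝟙 (does (triangleAt? v b x))

  triangleAt≡sorted : ∀ v b x → 𝟙 (does (triangleAt? v b x)) ≡
    𝟙 (does (sortedRainbowTriangle? v b x)) + 𝟙 (does (sortedRainbowTriangle? b v x)) +
    𝟙 (does (sortedRainbowTriangle? b x v))
  triangleAt≡sorted v b x = count (triangleAt? v b x)
    where
    vbx? = sortedRainbowTriangle? v b x
    bvx? = sortedRainbowTriangle? b v x
    bxv? = sortedRainbowTriangle? b x v
    count : (t? : Dec (TriangleAt v b x)) → 𝟙 (does t?) ≡ 𝟙 (does vbx?) + 𝟙 (does bvx?) + 𝟙 (does bxv?)
    count (no ¬t) = ≡.sym (cong₂ _+_ (cong₂ _+_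
      (𝟙-false vbx? λ (_ , b<x , t) → ¬t (b<x , t))
      (𝟙-false bvx? λ (b<v , v<x , t) → ¬t (<-trans b<v v<x , rainbowTriangle-swap₁₂ t)))
      (𝟙-false bxv? λ (b<x , _ , t) → ¬t (b<x , rainbowTriangle-swap₁₂ (rainbowTriangle-swap₂₃ t))))
    count (yes (b<x , t@(vb , _ , vx , _))) with <-cmp (toℕ v) (toℕ b) | <-cmp (toℕ v) (toℕ x)
    ... | tri≈ _ v≡b _ | _ = ⊥-elim (adj⇒≢ G vb (toℕ-injective v≡b))
    ... | _ | tri≈ _ v≡x _ = ⊥-elim (adj⇒≢ G vx (toℕ-injective v≡x))
    ... | tri< v<b _ _ | _ = ≡.sym (cong₂ _+_ (cong₂ _+_
      (𝟙-true vbx? (v<b , b<x , t))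
      (𝟙-false bvx? λ (b<v , _) → <-asym v<b b<v))
      (𝟙-false bxv? λ (_ , x<v , _) → <-asym (<-trans v<b b<x) x<v))
    ... | tri> _ _ b<v | tri< v<x _ _ = ≡.sym (cong₂ _+_ (cong₂ _+_
      (𝟙-false vbx? λ (v<b , _) → <-asym v<b b<v)
      (𝟙-true bvx? (b<v , v<x , rainbowTriangle-swap₁₂ t)))
      (𝟙-false bxv? λ (_ , x<v , _) → <-asym v<x x<v))
    ... | tri> _ _ b<v | tri> _ _ x<v = ≡.sym (cong₂ _+_ (cong₂ _+_
      (𝟙-false vbx? λ (v<b , _) → <-asym v<b b<v)
      (𝟙-false bvx? λ (_ , v<x , _) → <-asym v<x x<v))
      (𝟙-true bxv? (b<x , x<v , rainbowTriangle-swap₂₃ (rainbowTriangle-swap₁₂ t))))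

  ∑-trianglesAt : ∑[ v < n ] trianglesAt v ≡ #rainbowC3 G c * 3
  ∑-trianglesAt = begin
    ∑[ v < n ] trianglesAt v
      ≡⟨ sum-cong-≗ split ⟩
    ∑[ v < n ] (∑∑ (s v) + ∑∑ (λ b x → s b v x) + ∑∑ (λ b x → s b x v))
      ≡⟨ ∑-distrib₃ (λ v → ∑∑ (s v)) (λ v → ∑∑ (λ b x → s b v x)) (λ v → ∑∑ (λ b x → s b x v)) ⟩
    ∑∑∑s + ∑[ v < n ] ∑∑ (λ b x → s b v x) + ∑[ v < n ] ∑∑ (λ b x → s b x v)
      ≡⟨ cong₂ _+_ (cong (∑∑∑s +_) (∑-comm λ v b → ∑[ x < n ] s b v x))
                   (trans (∑-comm λ v b → ∑[ x < n ] s b x v) (sum-cong-≗ λ b → ∑-comm λ v x → s b x v)) ⟩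
    ∑∑∑s + ∑∑∑s + ∑∑∑s
      ≡⟨ cong (λ t → t + t + t) (≡.sym #rainbowC3≡∑) ⟩
    #rainbowC3 G c + #rainbowC3 G c + #rainbowC3 G c
      ≡⟨ m+m+m≡m*3 (#rainbowC3 G c) ⟩
    #rainbowC3 G c * 3 ∎
    where
    open ≡-Reasoning
    s : Fin n → Fin n → Fin n → ℕ
    s a b x = 𝟙 (does (sortedRainbowTriangle? a b x))
    ∑∑ : (Fin n → Fin n → ℕ) → ℕ
    ∑∑ f = ∑[ b < n ] ∑[ x < n ] f b x
    ∑∑∑s = ∑[ a < n ] ∑∑ (s a)
    split : ∀ v → trianglesAt v ≡ ∑∑ (s v) + ∑∑ (λ b x → s b v x) + ∑∑ (λ b x → s b x v)
    split v = trans
      (sum-cong-≗ λ b → trans (sum-cong-≗ (triangleAt≡sorted v b))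
                              (∑-distrib₃ (s v b) (λ x → s b v x) (λ x → s b x v)))
      (∑-distrib₃ (λ b → ∑[ x < n ] s v b x) (λ b → ∑[ x < n ] s b v x) (λ b → ∑[ x < n ] s b x v))

  neighbourPair? : ∀ v b x → Dec (toℕ b < toℕ x × adj G v b ≡ true × adj G v x ≡ true)
  neighbourPair? v b x = toℕ b <? toℕ x ×-dec adj? G v b ×-dec adj? G v x

  trianglesAt≤degreeC2 : ∀ v → trianglesAt v ≤ degree G v C 2
  trianglesAt≤degreeC2 v = ≤-trans
    (∑-mono-≤ λ b → ∑-mono-≤ λ x →
      𝟙-mono (λ (b<x , vb , _ , vx , _) → b<x , vb , vx) (triangleAt? v b x) (neighbourPair? v b x))
    (≤-reflexive (∑-pairs n (adj G v)))

  trianglesAt≡degreeC2 : ∀ v →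
    (∀ b x → adj G v b ≡ true → adj G v x ≡ true → b ≢ x → RainbowTriangle v b x) →
    trianglesAt v ≡ degree G v C 2
  trianglesAt≡degreeC2 v neighbours-rainbow = trans
    (sum-cong-≗ λ b → sum-cong-≗ λ x → cong 𝟙 (does-⇔
      (mk⇔ (λ (b<x , vb , _ , vx , _) → b<x , vb , vx)
           (λ (b<x , vb , vx) → b<x , neighbours-rainbow b x vb vx (λ { refl → <-irrefl refl b<x })))
      (triangleAt? v b x) (neighbourPair? v b x)))
    (∑-pairs n (adj G v))

  hasColour? : ∀ v κ d → Dec (adj G v d ≡ true × col c v d ≡ κ)
  hasColour? v κ d = adj? G v d ×-dec col c v d ≟ κ

  neighboursOfColour : Fin n → ℕ → ℕ
  neighboursOfColour v κ = ∑[ d < n ] 𝟙 (does (hasColour? v κ d))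

  neighboursOfColour≤1 : Proper G c → ∀ v κ → neighboursOfColour v κ ≤ 1
  neighboursOfColour≤1 proper v κ = ∑-atMostOne (hasColour? v κ) λ i j (vi , ci) (vj , cj) →
    decidable-stable (i ≟ᶠ j) λ i≢j → proper v i j vi vj i≢j (trans ci (≡.sym cj))

module _ {n} (G : Graph n) (c : EdgeColouring G) (proper : Proper G c) (noP3 : ¬ RainbowP3 G c) where

  rainbowTriangle⇒neighbourColour : ∀ {v p q d} → RainbowTriangle G c v p q → adj G v d ≡ true →
    col c v d ≡ col c v p ⊎ col c v d ≡ col c v q ⊎ col c v d ≡ col c p q
  rainbowTriangle⇒neighbourColour {v} {p} {q} {d} (vp , pq , vq , vp≢pq , _) vd
    with col c v d ≟ col c v p | col c v d ≟ col c v q | col c v d ≟ col c p q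
  ... | yes vd≡vp | _ | _ = inj₁ vd≡vp
  ... | _ | yes vd≡vq | _ = inj₂ (inj₁ vd≡vq)
  ... | _ | _ | yes vd≡pq = inj₂ (inj₂ vd≡pq)
  ... | no vd≢vp | no vd≢vq | no vd≢pq = ⊥-elim (noP3 (d , v , p , q ,
        ((λ d≡v → adj⇒≢ G vd (≡.sym d≡v)) , (λ d≡p → vd≢vp (cong (col c v) d≡p)) ,
         (λ d≡q → vd≢vq (cong (col c v) d≡q)) , adj⇒≢ G vp , adj⇒≢ G vq , adj⇒≢ G pq) ,
        (adj-sym G vd , vp , pq) ,
        ((λ e → vd≢vp (trans vd≡dv e)) , (λ e → vd≢pq (trans vd≡dv e)) , vp≢pq)))
    where vd≡dv = colSym c v d vd

  rainbowTriangle⇒degree≤3 : ∀ {v p q} → RainbowTriangle G c v p q → degree G v ≤ 3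
  rainbowTriangle⇒degree≤3 {v} {p} {q} t = begin
    degree G v
      ≤⟨ ∑-mono-≤ (λ d → 𝟙-cover₃ (cover d) (adj? G v d) (hasColour? G c v α d) (hasColour? G c v β d)
                                  (hasColour? G c v γ d)) ⟩
    ∑[ d < n ] (#α d + #β d + #γ d)
      ≡⟨ ∑-distrib₃ #α #β #γ ⟩
    neighboursOfColour G c v α + neighboursOfColour G c v β + neighboursOfColour G c v γ
      ≤⟨ +-mono-≤ (+-mono-≤ (≤1 α) (≤1 β)) (≤1 γ) ⟩
    3 ∎
    where
    open ≤-Reasoning
    α = col c v p
    β = col c v q
    γ = col c p q
    #_ : ℕ → Fin n → ℕ
    (# κ) d = 𝟙 (does (hasColour? G c v κ d))
    #α = # α
    #β = # β
    #γ = # γ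
    ≤1 = neighboursOfColour≤1 G c proper v
    cover : ∀ d → adj G v d ≡ true →
            (adj G v d ≡ true × col c v d ≡ α) ⊎ (adj G v d ≡ true × col c v d ≡ β) ⊎
            (adj G v d ≡ true × col c v d ≡ γ)
    cover d vd = Sum.map (vd ,_) (Sum.map (vd ,_) (vd ,_)) (rainbowTriangle⇒neighbourColour t vd)

  trianglesAt≤3 : ∀ v → trianglesAt G c v ≤ 3
  trianglesAt≤3 v with trianglesAt G c v ≟ 0
  ... | yes none = ≤-trans (≤-reflexive none) z≤n
  ... | no some with ∑≢0⇒∃≢0 _ some
  ...   | b , some-x with ∑≢0⇒∃≢0 _ some-x
  ...     | x , some-t = ≤-trans (trianglesAt≤degreeC2 G c v) (n≤3⇒nC2≤3
              (rainbowTriangle⇒degree≤3 (proj₂ (𝟙≢0⇒ (triangleAt? G c v b x) some-t))))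

  #rainbowC3≤n : #rainbowC3 G c ≤ n
  #rainbowC3≤n = *-cancelʳ-≤ _ _ 3 (begin
    #rainbowC3 G c * 3           ≡⟨ ∑-trianglesAt G c ⟨
    ∑[ v < n ] trianglesAt G c v ≤⟨ ∑-mono-≤ trianglesAt≤3 ⟩
    ∑[ v < n ] 3                 ≡⟨ ∑-const n 3 ⟩
    n * 3                        ∎)
    where open ≤-Reasoning

-- i xor j on two-bit labels: each colour class of K₄ is one of its three perfect matchings.
k4Colour : Fin 4 → Fin 4 → ℕ
k4Colour i j = lookup (lookup xorTable i) j
  where
  xorTable : Vec (Vec ℕ 4) 4
  xorTable = (0 ∷ 1 ∷ 2 ∷ 3 ∷ []) ∷
             (1 ∷ 0 ∷ 3 ∷ 2 ∷ []) ∷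
             (2 ∷ 3 ∷ 0 ∷ 1 ∷ []) ∷
             (3 ∷ 2 ∷ 1 ∷ 0 ∷ []) ∷ []

k4Colour-sym : ∀ i j → k4Colour i j ≡ k4Colour j i
k4Colour-sym = toWitness {a? = all? λ i → all? λ j → k4Colour i j ≟ k4Colour j i} _

k4Colour-injective : ∀ i j k → k4Colour i j ≡ k4Colour i k → j ≡ k
k4Colour-injective =
  toWitness {a? = all? λ i → all? λ j → all? λ k → k4Colour i j ≟ k4Colour i k →-dec j ≟ᶠ k} _

k4Colour-rainbow : ∀ a b x → a ≢ b → a ≢ x → b ≢ x →
                   k4Colour a b ≢ k4Colour b x × k4Colour a b ≢ k4Colour a x × k4Colour b x ≢ k4Colour a x
k4Colour-rainbow = toWitness {a? = all? λ a → all? λ b → all? λ x →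
  ¬? (a ≟ᶠ b) →-dec ¬? (a ≟ᶠ x) →-dec ¬? (b ≟ᶠ x) →-dec
  ¬? (k4Colour a b ≟ k4Colour b x) ×-dec ¬? (k4Colour a b ≟ k4Colour a x) ×-dec
  ¬? (k4Colour b x ≟ k4Colour a x)} _

k4Colour-matching : ∀ a b x d → a ≢ b → a ≢ x → a ≢ d → b ≢ x → b ≢ d → x ≢ d →
                    k4Colour a b ≡ k4Colour x d
k4Colour-matching = toWitness {a? = all? λ a → all? λ b → all? λ x → all? λ d →
  ¬? (a ≟ᶠ b) →-dec ¬? (a ≟ᶠ x) →-dec ¬? (a ≟ᶠ d) →-dec ¬? (b ≟ᶠ x) →-dec ¬? (b ≟ᶠ d) →-dec
  ¬? (x ≟ᶠ d) →-dec k4Colour a b ≟ k4Colour x d} _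

∑-otherCorners : ∀ k → ∑[ j < 4 ] 𝟙 (does (¬? (k ≟ᶠ j))) ≡ 3
∑-otherCorners 0F = refl
∑-otherCorners 1F = refl
∑-otherCorners 2F = refl
∑-otherCorners 3F = refl

module DisjointK4s (q : ℕ) where

  block : Fin (q * 4) → Fin q
  block = quotient {q} 4

  corner : Fin (q * 4) → Fin 4
  corner = remainder {q} 4

  block-combine : ∀ i j → block (combine i j) ≡ i
  block-combine i j = cong proj₁ (remQuot-combine {q} {4} i j)

  corner-combine : ∀ i j → corner (combine i j) ≡ j
  corner-combine i j = cong proj₂ (remQuot-combine {q} {4} i j)

  block-corner-injective : ∀ {u v} → block u ≡ block v → corner u ≡ corner v → u ≡ v
  block-corner-injective {u} {v} bu≡bv cu≡cv = trans (≡.sym (combine-remQuot {q} 4 u))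
    (trans (cong₂ combine bu≡bv cu≡cv) (combine-remQuot {q} 4 v))

  SameBlock : Fin (q * 4) → Fin (q * 4) → Set
  SameBlock u v = block u ≡ block v × u ≢ v

  sameBlock? : ∀ u v → Dec (SameBlock u v)
  sameBlock? u v = block u ≟ᶠ block v ×-dec ¬? (u ≟ᶠ v)

  sameBlock-sym : ∀ {u v} → SameBlock u v → SameBlock v u
  sameBlock-sym (bu≡bv , u≢v) = ≡.sym bu≡bv , λ v≡u → u≢v (≡.sym v≡u)

  sameBlock-irrefl : ∀ {v} → ¬ SameBlock v v
  sameBlock-irrefl (_ , v≢v) = v≢v refl

  sameBlock⇒corner≢ : ∀ {u v} → block u ≡ block v → u ≢ v → corner u ≢ corner v
  sameBlock⇒corner≢ bu≡bv u≢v cu≡cv = u≢v (block-corner-injective bu≡bv cu≡cv)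

  graph : Graph (q * 4)
  graph = relationGraph sameBlock? sameBlock-sym sameBlock-irrefl

  colouring : EdgeColouring graph
  colouring = record
    { col    = λ u v → k4Colour (corner u) (corner v)
    ; colSym = λ u v _ → k4Colour-sym (corner u) (corner v)
    }

  adj⇒sameBlock : ∀ {u v} → adj graph u v ≡ true → SameBlock u v
  adj⇒sameBlock = relationGraph-adj⇒ sameBlock? sameBlock-sym sameBlock-irrefl

  adj⇒block≡ : ∀ {u v} → adj graph u v ≡ true → block u ≡ block v
  adj⇒block≡ uv = proj₁ (adj⇒sameBlock uv)

  proper : Proper graph colouring
  proper u v w uv uw v≢w cuv≡cuw =
    sameBlock⇒corner≢ (trans (≡.sym (adj⇒block≡ uv)) (adj⇒block≡ uw)) v≢w
      (k4Colour-injective (corner u) (corner v) (corner w) cuv≡cuw)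

  noRainbowP3 : ¬ RainbowP3 graph colouring
  noRainbowP3 (a , b , x , d , (a≢b , a≢x , a≢d , b≢x , b≢d , x≢d) , (ab , bx , xd) , (_ , ab≢xd , _)) =
    ab≢xd (k4Colour-matching (corner a) (corner b) (corner x) (corner d)
      (sameBlock⇒corner≢ ba≡bb a≢b) (sameBlock⇒corner≢ (trans ba≡bb bb≡bx) a≢x)
      (sameBlock⇒corner≢ (trans ba≡bb (trans bb≡bx bx≡bd)) a≢d) (sameBlock⇒corner≢ bb≡bx b≢x)
      (sameBlock⇒corner≢ (trans bb≡bx bx≡bd) b≢d) (sameBlock⇒corner≢ bx≡bd x≢d))
    where
    ba≡bb = adj⇒block≡ ab
    bb≡bx = adj⇒block≡ bx
    bx≡bd = adj⇒block≡ xd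

  neighbours-rainbow : ∀ v b x → adj graph v b ≡ true → adj graph v x ≡ true → b ≢ x →
                       RainbowTriangle graph colouring v b x
  neighbours-rainbow v b x vb vx b≢x =
    vb , dec-true (sameBlock? b x) (bb≡bx , b≢x) , vx ,
    k4Colour-rainbow (corner v) (corner b) (corner x)
      (sameBlock⇒corner≢ bv≡bb v≢b) (sameBlock⇒corner≢ bv≡bx v≢x) (sameBlock⇒corner≢ bb≡bx b≢x)
    where
    bv≡bb = adj⇒block≡ vb
    bv≡bx = adj⇒block≡ vx
    v≢b = adj⇒≢ graph vb
    v≢x = adj⇒≢ graph vx
    bb≡bx = trans (≡.sym bv≡bb) bv≡bx

  degree≡3 : ∀ v → degree graph v ≡ 3
  degree≡3 v = begin
    degree graph v                                      ≡⟨ ∑-combine q (λ d → 𝟙 (adj graph v d)) ⟩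
    ∑[ i < q ] ∑[ j < 4 ] 𝟙 (adj graph v (combine i j)) ≡⟨ ∑-single (block v) otherBlock ⟩
    ∑[ j < 4 ] 𝟙 (adj graph v (combine (block v) j))    ≡⟨ sum-cong-≗ (λ j → cong 𝟙 (adj≡otherCorner j)) ⟩
    ∑[ j < 4 ] 𝟙 (does (¬? (corner v ≟ᶠ j)))            ≡⟨ ∑-otherCorners (corner v) ⟩
    3                                                   ∎
    where
    open ≡-Reasoning
    otherBlock : ∀ i → i ≢ block v → ∑[ j < 4 ] 𝟙 (adj graph v (combine i j)) ≡ 0
    otherBlock i i≢bv = trans
      (sum-cong-≗ λ j → 𝟙-false (sameBlock? v (combine i j))
                                λ (bv≡ , _) → i≢bv (≡.sym (trans bv≡ (block-combine i j))))
      (sum-replicate-zero 4)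
    to : ∀ {j} → SameBlock v (combine (block v) j) → corner v ≢ j
    to {j} (_ , v≢c) cv≡j =
      v≢c (block-corner-injective (≡.sym (block-combine _ j)) (trans cv≡j (≡.sym (corner-combine _ j))))
    from : ∀ {j} → corner v ≢ j → SameBlock v (combine (block v) j)
    from {j} cv≢j = ≡.sym (block-combine (block v) j) ,
                    λ v≡c → cv≢j (trans (cong corner v≡c) (corner-combine (block v) j))
    adj≡otherCorner : ∀ j → adj graph v (combine (block v) j) ≡ does (¬? (corner v ≟ᶠ j))
    adj≡otherCorner j = does-⇔ (mk⇔ to from) (sameBlock? v (combine (block v) j)) (¬? (corner v ≟ᶠ j))

  #rainbowC3≡q*4 : #rainbowC3 graph colouring ≡ q * 4
  #rainbowC3≡q*4 = *-cancelʳ-≡ _ _ 3 (begin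
    #rainbowC3 graph colouring * 3               ≡⟨ ∑-trianglesAt graph colouring ⟨
    ∑[ v < q * 4 ] trianglesAt graph colouring v ≡⟨ sum-cong-≗ (λ v → trans
      (trianglesAt≡degreeC2 graph colouring v (neighbours-rainbow v)) (cong (_C 2) (degree≡3 v))) ⟩
    ∑[ v < q * 4 ] 3                             ≡⟨ ∑-const (q * 4) 3 ⟩
    q * 4 * 3                                    ∎)
    where open ≡-Reasoning

theorem8 : (n : ℕ) → 0 < n → 4 ∣ n →
    ((G : Graph n) (c : EdgeColouring G) → Proper G c → ¬ RainbowP3 G c →
       #rainbowC3 G c ≤ n)
    × (Σ (Graph n) λ G → Σ (EdgeColouring G) λ c →
         Proper G c × ¬ RainbowP3 G c × #rainbowC3 G c ≡ n)
theorem8 .(q * 4) _ (divides q refl) =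
  #rainbowC3≤n , (graph , colouring , proper , noRainbowP3 , #rainbowC3≡q*4)
  where open DisjointK4s q
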